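{- Let $n\ge -1$ and let $(V,\in)$ be an $\in$-structure such that $x\in y$ is an $(n-1)$-type for all $x,y:V$ (an $\in$-structure of level $n$). Then $V$ is an $n$-type.
   Context: Homotopy type theory with univalent universes and function extensionality; type levels start at $-2$ (contractible types). An $\in$-structure is a type $V:\mathsf{Type}$ with $\in:V\to V\to\mathsf{Type}$ such that for all $x,y:V$ the canonical map $(x=y)\to\prod_{z:V}(z\in x\simeq z\in y)$ (sending $\mathrm{refl}$ to identity equivalences) is an equivalence. -}

{-# OPTIONS --without-K #-}
module Defs where

open import Level using (Level; _⊔_)
open import Data.Nat using (ℕ; zero; suc)
open import Data.Product using (Σ; _,_; proj₁; proj₂)
open import Relation.Binary.PropositionalEquality using (_≡_; refl)

private variable a b : Level

isContr : Set a → Set a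
isContr A = Σ A λ c → (x : A) → c ≡ x

-- hasLevel k A  means: A is a (k - 2)-type.
-- hasLevel 0 = contractible ((-2)-type), hasLevel 1 = proposition, hasLevel 2 = set, ...
hasLevel : ℕ → Set a → Set a
hasLevel zero    A = isContr A
hasLevel (suc k) A = (x y : A) → hasLevel k (x ≡ y)

fiber : {A : Set a} {B : Set b} → (A → B) → B → Set (a ⊔ b)
fiber {A = A} f y = Σ A λ x → f x ≡ y

isEquiv : {A : Set a} {B : Set b} → (A → B) → Set (a ⊔ b)
isEquiv {B = B} f = (y : B) → isContr (fiber f y)

_≃_ : Set a → Set b → Set (a ⊔ b)
A ≃ B = Σ (A → B) isEquiv

idIsEquiv : (A : Set a) → isEquiv (λ (x : A) → x)
idIsEquiv A y = (y , refl) , λ { (x , refl) → refl }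

idEquiv : (A : Set a) → A ≃ A
idEquiv A = (λ x → x) , idIsEquiv A

canonical : {ℓ : Level} {V : Set ℓ} (_∈_ : V → V → Set ℓ) (x y : V) →
            x ≡ y → (z : V) → (z ∈ x) ≃ (z ∈ y)
canonical _∈_ x .x refl z = idEquiv (z ∈ x)

isInStructure : {ℓ : Level} (V : Set ℓ) (_∈_ : V → V → Set ℓ) → Set ℓ
isInStructure V _∈_ = (x y : V) → isEquiv (canonical _∈_ x y)

{-# OPTIONS --without-K #-}
module Submission where

-- The canonical map (x ≡ y) → Π z (z ∈ x ≃ z ∈ y) is an equivalence, so x ≡ y is a retract of
-- Π z (z ∈ x ≃ z ∈ y). If every z ∈ x is an (n-1)-type, then so is each z ∈ x ≃ z ∈ y and hence
-- the product, because (n-1)-types are closed under Π, Σ and retracts and being an equivalence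
-- is a proposition. So all identity types of V are (n-1)-types, i.e. V is an n-type.

open import Defs
open import Level using (Level)
open import Data.Nat using (ℕ; suc; zero)
open import Data.Product using (Σ; _,_; proj₁; proj₂)
open import Data.Product.Properties using (Σ-≡,≡→≡; Σ-≡,≡←≡)
open import Axiom.Extensionality.Propositional using (Extensionality)
open import Relation.Binary.PropositionalEquality using (_≡_; refl; sym; trans; cong; cong-app; subst)
open import Relation.Binary.PropositionalEquality.Properties using (trans-symˡ)

private variable a b ℓ : Level

hasLevel-retract : {A : Set a} {B : Set b} (k : ℕ) (r : B → A) (s : A → B) →
                   ((x : A) → r (s x) ≡ x) → hasLevel k B → hasLevel k A
hasLevel-retract zero r s rs (c , contract) = r c , λ x → trans (cong r (contract (s x))) (rs x)
hasLevel-retract (suc k) r s rs hB x y =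
  hasLevel-retract k r′ (cong s) (λ { refl → trans-symˡ (rs x) }) (hB (s x) (s y))
  where
  r′ : s x ≡ s y → x ≡ y
  r′ p = trans (sym (rs x)) (trans (cong r p) (rs y))

hasLevel-suc : {A : Set a} (k : ℕ) → hasLevel k A → hasLevel (suc k) A
hasLevel-suc zero (c , contract) x y = trans (sym (contract x)) (contract y) , λ { refl → trans-symˡ (contract x) }
hasLevel-suc (suc k) hA x y = hasLevel-suc k (hA x y)

isProp→hasLevel-suc : {A : Set a} (k : ℕ) → hasLevel 1 A → hasLevel (suc k) A
isProp→hasLevel-suc zero    hA = hA
isProp→hasLevel-suc (suc k) hA = hasLevel-suc (suc k) (isProp→hasLevel-suc k hA)

hasLevel-Σ : {A : Set a} {B : A → Set b} (k : ℕ) →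
             hasLevel k A → ((x : A) → hasLevel k (B x)) → hasLevel k (Σ A B)
hasLevel-Σ {B = B} zero (c , contract) hB =
  (c , proj₁ (hB c)) ,
  λ { (x , y) → Σ-≡,≡→≡ (contract x , trans (sym (proj₂ (hB x) _)) (proj₂ (hB x) y)) }
hasLevel-Σ {B = B} (suc k) hA hB (x , u) (y , v) =
  hasLevel-retract k Σ-≡,≡→≡ Σ-≡,≡←≡ (λ { refl → refl })
    (hasLevel-Σ k (hA x y) (λ p → hB y (subst B p u) v))

module _ (fe : Extensionality a b) where

  -- Any function extensionality can be corrected to send pointwise refl to refl,
  -- which makes it a section of cong-app.
  funext : {A : Set a} {B : A → Set b} {f g : (x : A) → B x} → ((x : A) → f x ≡ g x) → f ≡ g
  funext {f = f} h = trans (sym (fe {f = f} λ _ → refl)) (fe h)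

  funext-cong-app : {A : Set a} {B : A → Set b} {f g : (x : A) → B x} (p : f ≡ g) →
                    funext (cong-app p) ≡ p
  funext-cong-app {f = f} refl = trans-symˡ (fe {f = f} λ _ → refl)

  hasLevel-Π : {A : Set a} {B : A → Set b} (k : ℕ) →
               ((x : A) → hasLevel k (B x)) → hasLevel k ((x : A) → B x)
  hasLevel-Π zero hB = (λ x → proj₁ (hB x)) , λ f → fe λ x → proj₂ (hB x) (f x)
  hasLevel-Π (suc k) hB f g =
    hasLevel-retract k funext cong-app funext-cong-app (hasLevel-Π k λ x → hB x (f x) (g x))

module _ (fe : Extensionality ℓ ℓ) where

  -- An inhabitant c of isContr A makes A a proposition, and then isContr A is one too.
  isContr-isProp : {A : Set ℓ} → hasLevel 1 (isContr A)
  isContr-isProp {A} c = hasLevel-Σ 1 A-isProp (λ x → hasLevel-Π fe 1 λ y → hasLevel-suc 1 A-isProp x y) c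
    where
    A-isProp : hasLevel 1 A
    A-isProp = hasLevel-suc 0 c

  isContr-isContr : {A : Set ℓ} → isContr A → isContr (isContr A)
  isContr-isContr c = c , λ c′ → proj₁ (isContr-isProp c c′)

  isEquiv-isProp : {A B : Set ℓ} (f : A → B) → hasLevel 1 (isEquiv f)
  isEquiv-isProp f = hasLevel-Π fe 1 λ _ → isContr-isProp

  isEquiv-isContr : {A B : Set ℓ} (f : A → B) → isContr A → isContr B → isContr (isEquiv f)
  isEquiv-isContr f hA hB =
    hasLevel-Π fe 0 λ y → isContr-isContr (hasLevel-Σ 0 hA λ x → hasLevel-suc 0 hB (f x) y)

  hasLevel-≃ : {A B : Set ℓ} (k : ℕ) → hasLevel k A → hasLevel k B → hasLevel k (A ≃ B)
  hasLevel-≃ zero hA hB = hasLevel-Σ 0 (hasLevel-Π fe 0 λ _ → hB) λ f → isEquiv-isContr f hA hB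
  hasLevel-≃ (suc k) hA hB =
    hasLevel-Σ (suc k) (hasLevel-Π fe (suc k) λ _ → hB) λ f → isProp→hasLevel-suc k (isEquiv-isProp f)

isEquiv→retraction : {A : Set a} {B : Set b} {f : A → B} →
                     isEquiv f → Σ (B → A) λ g → (x : A) → g (f x) ≡ x
isEquiv→retraction {f = f} e =
  (λ y → proj₁ (proj₁ (e y))) , λ x → cong proj₁ (proj₂ (e (f x)) (x , refl))

mainTheorem15 : {ℓ : Level} → Extensionality ℓ ℓ → (m : ℕ) (V : Set ℓ) (_∈_ : V → V → Set ℓ) → isInStructure V _∈_ → ((x y : V) → hasLevel m (x ∈ y)) → hasLevel (suc m) V
mainTheorem15 fe m V _∈_ isInStr ∈-level x y =
  hasLevel-retract m (proj₁ retraction) (canonical _∈_ x y) (proj₂ retraction)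
    (hasLevel-Π fe m λ z → hasLevel-≃ fe m (∈-level z x) (∈-level z y))
  where
  retraction : Σ (((z : V) → (z ∈ x) ≃ (z ∈ y)) → x ≡ y) λ g → (p : x ≡ y) → g (canonical _∈_ x y p) ≡ p
  retraction = isEquiv→retraction (isInStr x y)
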